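{- Let $T$ be a full binary tree with $n$ internal nodes and height $h$. Then the rotation distance from $T$ to a nearest full skew tree with $n$ internal nodes is exactly $n-h$; that is, $\min\{d(T,S): S \text{ a full skew tree with } n \text{ internal nodes}\}=n-h$.
   Context: A full binary tree is a rooted ordered tree whose nodes are leaves or internal nodes with exactly two children; a full skew tree is one in which every internal node has at least one leaf child. The height of a full binary tree is the number of internal nodes on a longest root-to-leaf path. A right rotation at an internal node $a$ whose left child $b$ is internal, with $C,D$ the subtrees of $b$ and $E$ the right subtree of $a$, replaces the subtree at $a$ by the tree with root $b$, left subtree $C$, right child $a$ having subtrees $D,E$; a left rotation is its inverse. $d(T_1,T_2)$ is the minimum number of rotations (with no restriction on intermediate trees) transforming $T_1$ into $T_2$. -}

module Defs where

open import Data.Nat using (ℕ; zero; suc; _+_; _⊔_)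

data Tree : Set where
  leaf : Tree
  node : Tree → Tree → Tree

internal : Tree → ℕ
internal leaf       = zero
internal (node l r) = suc (internal l + internal r)

height : Tree → ℕ
height leaf       = zero
height (node l r) = suc (height l ⊔ height r)

data Skew : Tree → Set where
  skew-leaf  : Skew leaf
  skew-left  : ∀ {r} → Skew r → Skew (node leaf r)
  skew-right : ∀ {l} → Skew l → Skew (node l leaf)

data Rot : Tree → Tree → Set where
  rotR : ∀ C D E → Rot (node (node C D) E) (node C (node D E))
  rotL : ∀ C D E → Rot (node C (node D E)) (node (node C D) E)
  inL  : ∀ {l l′} r → Rot l l′ → Rot (node l r) (node l′ r)
  inR  : ∀ l {r r′} → Rot r r′ → Rot (node l r) (node l r′)

data Steps : ℕ → Tree → Tree → Set where
  done : ∀ {T} → Steps zero T T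
  step : ∀ {k T₁ T₂ T₃} → Rot T₁ T₂ → Steps k T₂ T₃ → Steps (suc k) T₁ T₃

-- A rotation changes the height by at most one and preserves the number of
-- internal nodes, while a full skew tree is exactly a tree whose height equals
-- its number n of internal nodes; so at least n − h rotations are needed.
-- Conversely, if h < n, descend from the root through nodes with a leaf child
-- to a node with two internal children; the rotation there that pushes its
-- taller subtree one level deeper raises the height by one, so n − h
-- rotations suffice.
module Submission where

open import Defs
open import Data.Nat using (ℕ; zero; suc; _+_; _∸_; _⊔_; _≤_; _<_; z≤n; s≤s; s≤s⁻¹)
open import Data.Nat.Properties
open import Data.Product using (Σ; _×_; _,_)
open import Data.Sum using (inj₁; inj₂)
open import Data.Empty using (⊥-elim)
open import Relation.Binary.PropositionalEquality

+-suc-reassoc : ∀ c d e → c + suc (d + e) ≡ suc (c + d) + e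
+-suc-reassoc c d e = trans (+-suc c (d + e)) (cong suc (sym (+-assoc c d e)))

internal-rot : ∀ {T T′} → Rot T T′ → internal T′ ≡ internal T
internal-rot (rotR C D E) = cong suc (+-suc-reassoc (internal C) (internal D) (internal E))
internal-rot (rotL C D E) = cong suc (sym (+-suc-reassoc (internal C) (internal D) (internal E)))
internal-rot (inL r p) = cong (λ x → suc (x + internal r)) (internal-rot p)
internal-rot (inR l p) = cong (λ x → suc (internal l + x)) (internal-rot p)

internal-steps : ∀ {k T S} → Steps k T S → internal S ≡ internal T
internal-steps done       = refl
internal-steps (step r s) = trans (internal-steps s) (internal-rot r)

height-rot : ∀ {T T′} → Rot T T′ → height T′ ≤ suc (height T)
height-rot (rotR C D E) = s≤s (⊔-lub c≤ (s≤s (⊔-monoˡ-≤ e (m≤n⇒m≤1+n (m≤n⊔m c d)))))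
  where
  c d e : ℕ
  c = height C ; d = height D ; e = height E
  c≤ : c ≤ suc (suc (c ⊔ d) ⊔ e)
  c≤ = m≤n⇒m≤1+n (m≤n⇒m≤n⊔o e (m≤n⇒m≤1+n (m≤m⊔n c d)))
height-rot (rotL C D E) = s≤s (⊔-lub (s≤s (⊔-monoʳ-≤ c (m≤n⇒m≤1+n (m≤m⊔n d e)))) e≤)
  where
  c d e : ℕ
  c = height C ; d = height D ; e = height E
  e≤ : e ≤ suc (c ⊔ suc (d ⊔ e))
  e≤ = m≤n⇒m≤1+n (m≤n⇒m≤o⊔n c (m≤n⇒m≤1+n (m≤n⊔m d e)))
height-rot (inL r p) = s≤s (⊔-mono-≤ (height-rot p) (n≤1+n (height r)))
height-rot (inR l p) = s≤s (⊔-mono-≤ (n≤1+n (height l)) (height-rot p))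

height-steps : ∀ {k T S} → Steps k T S → height S ≤ height T + k
height-steps {T = T} done = ≤-reflexive (sym (+-identityʳ (height T)))
height-steps {suc k} {T} (step r s) = begin
  _                      ≤⟨ height-steps s ⟩
  _ + k                  ≤⟨ +-monoˡ-≤ k (height-rot r) ⟩
  suc (height T) + k     ≡⟨ sym (+-suc (height T) k) ⟩
  height T + suc k       ∎
  where open ≤-Reasoning

height≤internal : ∀ T → height T ≤ internal T
height≤internal leaf       = z≤n
height≤internal (node l r) =
  s≤s (≤-trans (⊔-mono-≤ (height≤internal l) (height≤internal r)) (m⊔n≤m+n (internal l) (internal r)))

height≡internal-skew : ∀ {S} → Skew S → height S ≡ internal S
height≡internal-skew skew-leaf          = refl
height≡internal-skew (skew-left s)      = cong suc (height≡internal-skew s)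
height≡internal-skew (skew-right {l} s) =
  cong suc (trans (⊔-identityʳ (height l)) (trans (height≡internal-skew s) (sym (+-identityʳ _))))

skew-height≡internal : ∀ T → height T ≡ internal T → Skew T
skew-height≡internal leaf _ = skew-leaf
skew-height≡internal (node leaf r) eq = skew-left (skew-height≡internal r (suc-injective eq))
skew-height≡internal (node l@(node _ _) leaf) eq =
  skew-right (skew-height≡internal l (trans (sym (⊔-identityʳ _)) (trans (suc-injective eq) (+-identityʳ _))))
skew-height≡internal (node l@(node a b) r@(node c d)) eq = ⊥-elim (<⇒≢ height<internal (suc-injective eq))
  where
  x y : ℕ
  x = internal a + internal b ; y = internal c + internal d
  height<internal : height l ⊔ height r < suc x + suc y
  height<internal = begin-strict
    height l ⊔ height r  ≤⟨ ⊔-mono-≤ (height≤internal l) (height≤internal r) ⟩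
    suc x ⊔ suc y        ≤⟨ s≤s (m⊔n≤m+n x y) ⟩
    suc (x + y)          <⟨ s≤s (n<1+n (x + y)) ⟩
    suc (suc (x + y))    ≡⟨ cong suc (sym (+-suc x y)) ⟩
    suc x + suc y        ∎
    where open ≤-Reasoning

height-raising-rot : ∀ T → height T < internal T → Σ Tree λ T′ → Rot T T′ × suc (height T) ≤ height T′
height-raising-rot leaf ()
height-raising-rot (node l r) lt with ≤-total (height l) (height r)
height-raising-rot (node leaf r) lt | inj₁ _ with height-raising-rot r (s≤s⁻¹ lt)
... | r′ , rot , raised = node leaf r′ , inR leaf rot , s≤s raised
height-raising-rot (node (node a b) r) lt | inj₁ hl≤hr =
  node a (node b r) , rotR a b r ,
  s≤s (m≤n⇒m≤o⊔n (height a) (s≤s (≤-trans (≤-reflexive (m≤n⇒m⊔n≡n hl≤hr)) (m≤n⊔m (height b) (height r)))))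
height-raising-rot (node l leaf) lt | inj₂ _ with height-raising-rot l lt′
  where
  lt′ : height l < internal l
  lt′ = subst₂ _<_ (⊔-identityʳ (height l)) (+-identityʳ _) (s≤s⁻¹ lt)
... | l′ , rot , raised =
  node l′ leaf , inL leaf rot ,
  s≤s (subst₂ _≤_ (cong suc (sym (⊔-identityʳ (height l)))) (sym (⊔-identityʳ _)) raised)
height-raising-rot (node l (node a b)) lt | inj₂ hr≤hl =
  node (node l a) b , rotL l a b ,
  s≤s (m≤n⇒m≤n⊔o (height b) (s≤s (≤-trans (≤-reflexive (m≥n⇒m⊔n≡m hr≤hl)) (m≤m⊔n (height l) (height a)))))

steps-to-skew : ∀ d T → internal T ≡ height T + d → Σ Tree λ S → Skew S × Steps d T S
steps-to-skew zero T eq = T , skew-height≡internal T (sym (trans eq (+-identityʳ _))) , done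
steps-to-skew (suc d) T eq with height-raising-rot T lt
  where
  lt : height T < internal T
  lt = subst (height T <_) (trans (sym (+-suc (height T) d)) (sym eq)) (s≤s (m≤m+n (height T) d))
... | T′ , rot , raised with steps-to-skew d T′ eq′
  where
  eq′ : internal T′ ≡ height T′ + d
  eq′ = begin
    internal T′             ≡⟨ internal-rot rot ⟩
    internal T              ≡⟨ eq ⟩
    height T + suc d        ≡⟨ +-suc (height T) d ⟩
    suc (height T) + d      ≡⟨ cong (_+ d) (≤-antisym raised (height-rot rot)) ⟩
    height T′ + d           ∎
    where open ≡-Reasoning
... | S , skew , steps = S , skew , step rot steps

internal≤height+steps-to-skew : ∀ {k T S} → Skew S → Steps k T S → internal T ≤ height T + k
internal≤height+steps-to-skew {T = T} skew steps =
  subst (_≤ height T + _) (trans (height≡internal-skew skew) (internal-steps steps)) (height-steps steps)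

proposition2 : (n h : ℕ) (T : Tree) → internal T ≡ n → height T ≡ h →
    (Σ Tree λ S → Skew S × internal S ≡ n × Steps (n ∸ h) T S)
    × (∀ S k → Skew S → internal S ≡ n → Steps k T S → n ∸ h ≤ k)
proposition2 _ _ T refl refl = upper , lower
  where
  upper : Σ Tree λ S → Skew S × internal S ≡ internal T × Steps (internal T ∸ height T) T S
  upper with steps-to-skew (internal T ∸ height T) T (sym (m+[n∸m]≡n (height≤internal T)))
  ... | S , skew , steps = S , skew , internal-steps steps , steps
  lower : ∀ S k → Skew S → internal S ≡ internal T → Steps k T S → internal T ∸ height T ≤ k
  lower S k skew _ steps = m≤n+o⇒m∸n≤o (internal T) (height T) (internal≤height+steps-to-skew skew steps)
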